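{- Let $G$ be a graph on $n$ vertices with a vertex ordering $(v_1,\dots,v_n)$ such that $d^-(v_i)>0$ for all $i\ge 2$, and let $\phi$ be a strong parity edge-coloring of $G$. Then the number of colors used by $\phi$ is at least $L$, where $L$ is the minimum, over all sets of $\lceil\log_2 n\rceil$ distinct vertices of $G$, of the sum of their back-degrees.
   Context: The back-degree $d^-(v_i)$ is the number of neighbors of $v_i$ among $v_1,\dots,v_{i-1}$ (so $d^-(v_1)=0$). An edge-coloring assigns a color to each edge; a walk is a parity walk if every color appears an even number of times along it (with multiplicity), and open if its endpoints are distinct. A strong parity edge-coloring is an edge-coloring with no open parity walk. -}

module Defs where

open import Data.Bool using (Bool; true; false; T; if_then_else_)
open import Data.Nat using (ℕ; zero; suc; _+_; _<_; _<ᵇ_)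
open import Data.Nat.Properties using (_≟_)
open import Data.Fin using (Fin; toℕ)
open import Data.Fin.Subset using (Subset; _∈_)
open import Data.Fin.Subset.Properties using (_∈?_)
open import Data.List using (List; []; _∷_; length; filter; map; allFin; deduplicate; concatMap)
open import Data.Product using (∃)
open import Data.Nat.ListAction using (sum)
open import Relation.Nullary using (¬_; yes; no)
open import Relation.Binary.PropositionalEquality using (_≡_)

-- A finite simple graph on the vertex set Fin n; the vertex ordering
-- (v_1,…,v_n) is the index order of Fin n (v_{i+1} = the vertex i).
record Graph (n : ℕ) : Set where
  field
    adj   : Fin n → Fin n → Bool
    sym   : ∀ i j → adj i j ≡ adj j i
    irrefl : ∀ i → adj i i ≡ false
open Graph public

-- An edge-coloring with colors in ℕ: a symmetric function on pairs of
-- vertices, whose values are only relevant on edges.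
record EdgeColoring {n : ℕ} (G : Graph n) : Set where
  field
    col    : Fin n → Fin n → ℕ
    colSym : ∀ i j → col i j ≡ col j i
open EdgeColoring public

Even : ℕ → Set
Even m = ∃ λ k → m ≡ k + k

module _ {n : ℕ} (G : Graph n) where

  IsWalkFrom : Fin n → List (Fin n) → Set
  IsWalkFrom u []       = Data.Unit.⊤ where import Data.Unit
  IsWalkFrom u (w ∷ ws) = T (adj G u w) Data.Product.× IsWalkFrom w ws
    where import Data.Product

  lastVertex : Fin n → List (Fin n) → Fin n
  lastVertex u []       = u
  lastVertex u (w ∷ ws) = lastVertex w ws

  backDeg : Fin n → ℕ
  backDeg i = length (filter (λ j → toℕ j Data.Nat.<? toℕ i) (filter (λ j → Data.Bool.Properties.T? (adj G i j)) (allFin n)))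
    where import Data.Bool.Properties

  backDegSum : Subset n → ℕ
  backDegSum S = sum (map backDeg (filter (_∈? S) (allFin n)))

  module _ (φ : EdgeColoring G) where

    walkColors : Fin n → List (Fin n) → List ℕ
    walkColors u []       = []
    walkColors u (w ∷ ws) = col φ u w ∷ walkColors w ws

    IsParityWalk : Fin n → List (Fin n) → Set
    IsParityWalk u ws = ∀ (c : ℕ) → Even (length (filter (c ≟_) (walkColors u ws)))

    IsOpenWalk : Fin n → List (Fin n) → Set
    IsOpenWalk u ws = ¬ (u ≡ lastVertex u ws)

    IsStrongParity : Set
    IsStrongParity = ∀ u ws → IsWalkFrom u ws → IsParityWalk u ws → ¬ IsOpenWalk u ws

    edgeColors : List ℕ
    edgeColors = concatMap (λ i → map (col φ i)
                   (filter (λ j → Data.Bool.Properties.T? (adj G i j)) (filter (λ j → toℕ i Data.Nat.<? toℕ j) (allFin n))))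
                   (allFin n)
      where import Data.Bool.Properties

    numColors : ℕ
    numColors = length (deduplicate _≟_ edgeColors)

-- Call v_i fresh if none of its back edges has the colour of an edge among v_1, …, v_{i-1}.
-- By induction along the ordering, every v_i is joined to v_1 by a walk whose colour parity is
-- Σ_{j ∈ σ_i} [c_j], where σ_i is a set of fresh vertices and c_j a back colour of v_j: a fresh
-- vertex extends a walk to one of its back neighbours, and a non-fresh v_i, whose back edge u v_i
-- repeats the colour of an edge x y, is reached via v_1 → x → y → v_1 → u → v_i, in which that
-- colour cancels.  Under a strong parity colouring two vertices with the same σ are joined by a
-- parity walk, hence equal, so n ≤ 2^(number of fresh vertices).  Back edges at one vertex, or at
-- two distinct fresh vertices, never share a colour, so any ⌈log₂ n⌉ fresh vertices have
-- back-degree sum at most the number of colours.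

module Submission where

open import Defs
open import Data.Nat using (ℕ; _≤_; _<_; _>_)
open import Data.Nat.Logarithm using (⌈log₂_⌉)
open import Data.Fin using (Fin; toℕ)
open import Data.Fin.Subset using (Subset; ∣_∣)
open import Data.Product using (Σ; _×_)
open import Relation.Binary.PropositionalEquality using (_≡_)

open import Algebra.Bundles using (CommutativeRing)
open import Level using (Level)
open import Data.Bool using (Bool; true; false; T; _xor_; _∧_; if_then_else_)
open import Data.Bool.Properties
  using (T?; xor-assoc; xor-comm; xor-same; xor-identityʳ; ∧-distribʳ-xor; xor-∧-commutativeRing)
open import Data.Empty using (⊥-elim)
open import Data.Fin using (zero; suc)
open import Data.Fin.Induction using (<-wellFounded)
open import Data.Fin.Properties
  using (any?; <-cmp; <-trans; injective⇒≤; combine-injectiveˡ; combine-injectiveʳ; 2↔Bool)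
  renaming (_≟_ to _≟ᶠ_; _<?_ to _<ᶠ?_)
open import Data.Fin.Base using (combine) renaming (_<_ to _<ᶠ_)
open import Data.Fin.Subset using (_⊆_; ⊥; ⁅_⁆; inside; outside) renaming (_∈_ to _∈ˢ_)
open import Data.Fin.Subset.Properties
  using (_∈?_; drop-∷-⊆; out⊆; s⊆s; ⊆-refl; ⊆-min; ∣⊥∣≡0; x∈⁅y⁆⇒x≡y)
open import Data.List using (List; []; _∷_; _++_; length; filter; map; allFin; concatMap)
open import Data.List.Properties using (length-++; length-map)
open import Data.List.Membership.Propositional using (_∈_; find; lose)
open import Data.List.Membership.Propositional.Properties
  using ( ∈-filter⁺; ∈-filter⁻; ∈-map⁺; ∈-map⁻; ∈-concatMap⁺; ∈-concatMap⁻; ∈-deduplicate⁺; ∈-allFin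
        ; ∈-∃++; ∈-++⁻; ∈-++⁺ˡ; ∈-++⁺ʳ)
open import Data.List.Relation.Binary.Disjoint.Propositional using (Disjoint)
open import Data.List.Relation.Unary.All as All using (All; []; _∷_)
open import Data.List.Relation.Unary.All.Properties using (all-filter; map⁺)
open import Data.List.Relation.Unary.Any using (here; there)
open import Data.List.Relation.Unary.Unique.Propositional using (Unique; []; _∷_)
import Data.List.Relation.Unary.Unique.Propositional.Properties as Unique
open import Data.Nat using (zero; suc; _+_; _^_; _≡ᵇ_; _<?_; z≤n; s≤s)
open import Data.Nat.Properties using (_≟_; +-suc; module ≤-Reasoning)
open import Data.Nat.ListAction using (sum)
open import Data.Nat.Logarithm using (⌈log₂⌉-mono-≤; ⌈log₂2^n⌉≡n)
open import Data.Product using (∃; _,_; proj₁; proj₂)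
open import Data.Sum using (inj₁; inj₂)
open import Data.Unit using (tt)
open import Data.Vec using ([]; _∷_; lookup; tabulate; zipWith)
import Data.Vec as Vec
open import Data.Vec.Properties using ([]=⇒lookup; lookup⇒[]=; lookup-zipWith; lookup∘tabulate)
open import Function using (_∘_; const)
open import Function.Bundles using (Injection; _↣_)
open import Function.Properties.Inverse using (↔-sym; ↔⇒↣)
import Induction.WellFounded as WF
open import Relation.Binary using (tri<; tri≈; tri>)
open import Relation.Binary.PropositionalEquality
  using (_≢_; refl; trans; cong; cong₂; subst; _≗_; module ≡-Reasoning)
import Relation.Binary.PropositionalEquality as ≡
open import Relation.Nullary using (¬_; yes; no; does; contradiction)
open import Relation.Nullary.Decidable using (dec-true; dec-false; decidable-stable; ¬?; _×-dec_)
open import Relation.Unary using (Pred; Decidable)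

open import Algebra.Properties.CommutativeSemigroup
  (CommutativeRing.+-commutativeSemigroup xor-∧-commutativeRing)
  using (interchange; xy∙z≈xz∙y)

-- Colour parities

Parity : Set
Parity = ℕ → Bool

_⊕_ : Parity → Parity → Parity
(X ⊕ Y) c = X c xor Y c

single : ℕ → Parity
single c d = does (d ≟ c)

parity : List ℕ → Parity
parity []       = const false
parity (c ∷ cs) = single c ⊕ parity cs

parity-++ : ∀ xs ys → parity (xs ++ ys) ≗ parity xs ⊕ parity ys
parity-++ []       ys d = refl
parity-++ (x ∷ xs) ys d =
  trans (cong (single x d xor_) (parity-++ xs ys d)) (≡.sym (xor-assoc (single x d) (parity xs d) (parity ys d)))

count≡parity : ∀ cs c → ∃ λ k →
  length (filter (c ≟_) cs) ≡ (if parity cs c then suc (k + k) else k + k)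
count≡parity []       c = 0 , refl
count≡parity (x ∷ cs) c with count≡parity cs c | c ≡ᵇ x
... | k , eq | false = k , eq
... | k , eq | true with parity cs c
...   | true  = suc k , cong suc (trans eq (≡.sym (+-suc k k)))
...   | false = k , cong suc eq

even-count : ∀ cs c → parity cs c ≡ false → Even (length (filter (c ≟_) cs))
even-count cs c even with count≡parity cs c
... | k , eq rewrite even = k , eq

xor-cancel : ∀ a b c e → ((a xor e) xor b) xor (c xor e) ≡ (a xor b) xor c
xor-cancel a b c e = begin
  ((a xor e) xor b) xor (c xor e)  ≡⟨ cong (_xor (c xor e)) (xy∙z≈xz∙y a e b) ⟩
  ((a xor b) xor e) xor (c xor e)  ≡⟨ interchange (a xor b) e c e ⟩
  ((a xor b) xor c) xor (e xor e)  ≡⟨ cong (((a xor b) xor c) xor_) (xor-same e) ⟩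
  ((a xor b) xor c) xor false      ≡⟨ xor-identityʳ _ ⟩
  (a xor b) xor c                  ∎
  where open ≡-Reasoning

-- Walks with a prescribed colour parity

T-adj-sym : ∀ {n} (G : Graph n) {a b} → T (adj G a b) → T (adj G b a)
T-adj-sym G {a} {b} = subst T (sym G a b)

module Walks {n : ℕ} (G : Graph n) (φ : EdgeColoring G) where

  record Walk (a b : Fin n) (X : Parity) : Set where
    constructor walk
    field
      route   : List (Fin n)
      isWalk  : IsWalkFrom G a route
      ends    : lastVertex G a route ≡ b
      parity≗ : parity (walkColors G φ a route) ≗ X

  private variable
    a b c : Fin n
    X Y : Parity

  isWalk-++ : ∀ a xs ys → IsWalkFrom G a xs → IsWalkFrom G (lastVertex G a xs) ys → IsWalkFrom G a (xs ++ ys)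
  isWalk-++ a []       ys _          w′ = w′
  isWalk-++ a (x ∷ xs) ys (a~x , w) w′ = a~x , isWalk-++ x xs ys w w′

  lastVertex-++ : ∀ a xs ys → lastVertex G a (xs ++ ys) ≡ lastVertex G (lastVertex G a xs) ys
  lastVertex-++ a []       ys = refl
  lastVertex-++ a (x ∷ xs) ys = lastVertex-++ x xs ys

  walkColors-++ : ∀ a xs ys →
    walkColors G φ a (xs ++ ys) ≡ walkColors G φ a xs ++ walkColors G φ (lastVertex G a xs) ys
  walkColors-++ a []       ys = refl
  walkColors-++ a (x ∷ xs) ys = cong (col φ a x ∷_) (walkColors-++ x xs ys)

  cast : X ≗ Y → Walk a b X → Walk a b Y
  cast X≗Y (walk ws w e p) = walk ws w e (λ d → trans (p d) (X≗Y d))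

  stay : ∀ a → Walk a a (const false)
  stay a = walk [] tt refl (λ _ → refl)

  edge : T (adj G a b) → Walk a b (single (col φ a b))
  edge {b = b} a~b = walk (b ∷ []) (a~b , tt) refl (λ _ → xor-identityʳ _)

  _++ʷ_ : Walk a b X → Walk b c Y → Walk a c (X ⊕ Y)
  _++ʷ_ {a = a} {X = X} {Y = Y} (walk xs w refl p) (walk ys w′ refl q) =
    walk (xs ++ ys) (isWalk-++ a xs ys w w′) (lastVertex-++ a xs ys) λ d → begin
      parity (walkColors G φ a (xs ++ ys)) d
        ≡⟨ cong (λ cs → parity cs d) (walkColors-++ a xs ys) ⟩
      parity (walkColors G φ a xs ++ walkColors G φ (lastVertex G a xs) ys) d
        ≡⟨ parity-++ (walkColors G φ a xs) _ d ⟩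
      parity (walkColors G φ a xs) d xor parity (walkColors G φ (lastVertex G a xs) ys) d
        ≡⟨ cong₂ _xor_ (p d) (q d) ⟩
      X d xor Y d ∎
    where open ≡-Reasoning

  reverse-route : ∀ a ws → IsWalkFrom G a ws → Walk (lastVertex G a ws) a (parity (walkColors G φ a ws))
  reverse-route a []       _          = stay a
  reverse-route a (w ∷ ws) (a~w , wk) =
    cast swap (reverse-route w ws wk ++ʷ edge (T-adj-sym G a~w))
    where
    swap : parity (walkColors G φ w ws) ⊕ single (col φ w a) ≗ parity (walkColors G φ a (w ∷ ws))
    swap d = trans (xor-comm (parity (walkColors G φ w ws) d) _)
                   (cong (λ c → single c d xor parity (walkColors G φ w ws) d) (colSym φ w a))

  reverse : Walk a b X → Walk b a X
  reverse (walk ws w refl p) = cast p (reverse-route _ ws w)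

  closed : IsStrongParity G φ → Walk a b (const false) → a ≡ b
  closed {a} {b} sp (walk ws w e p) = decidable-stable (a ≟ᶠ b) λ a≢b →
    sp a ws w (λ c → even-count (walkColors G φ a ws) c (p c)) (λ a≡end → a≢b (trans a≡end e))

private variable
  ℓ : Level
  n : ℕ
  p σ τ : Subset n

_△_ : Subset n → Subset n → Subset n
_△_ = zipWith _xor_

△-⊆ : σ ⊆ p → τ ⊆ p → σ △ τ ⊆ p
△-⊆ {σ = σ} {τ = τ} σ⊆p τ⊆p {x} x∈σ△τ with lookup σ x in σx
... | true  = σ⊆p (lookup⇒[]= x σ σx)
... | false = τ⊆p (lookup⇒[]= x τ (begin
  lookup τ x                    ≡⟨ cong (_xor lookup τ x) σx ⟨
  lookup σ x xor lookup τ x     ≡⟨ lookup-zipWith _xor_ x σ τ ⟨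
  lookup (σ △ τ) x              ≡⟨ []=⇒lookup x∈σ△τ ⟩
  true                          ∎))
  where open ≡-Reasoning

satisfying : {P : Pred (Fin n) ℓ} → Decidable P → Subset n
satisfying P? = tabulate (does ∘ P?)

module _ {P : Pred (Fin n) ℓ} (P? : Decidable P) {i : Fin n} where

  ∈-satisfying⁺ : P i → i ∈ˢ satisfying P?
  ∈-satisfying⁺ Pi = lookup⇒[]= i _ (trans (lookup∘tabulate _ i) (dec-true (P? i) Pi))

  ∈-satisfying⁻ : i ∈ˢ satisfying P? → P i
  ∈-satisfying⁻ i∈ = decidable-stable (P? i) λ ¬Pi →
    contradiction (trans (≡.sym (dec-false (P? i) ¬Pi)) does≡true) λ ()
    where
    does≡true : does (P? i) ≡ true
    does≡true = trans (≡.sym (lookup∘tabulate _ i)) ([]=⇒lookup i∈)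

⊆-ofSize : ∀ (p : Subset n) {t} → t ≤ ∣ p ∣ → Σ (Subset n) λ q → q ⊆ p × ∣ q ∣ ≡ t
⊆-ofSize []            z≤n = [] , ⊆-refl , refl
⊆-ofSize (outside ∷ p) t≤  = let q , q⊆p , ∣q∣ = ⊆-ofSize p t≤ in outside ∷ q , out⊆ q⊆p , ∣q∣
⊆-ofSize {suc n} (inside ∷ p) {zero} _ = ⊥ , ⊆-min (inside ∷ p) , ∣⊥∣≡0 (suc n)
⊆-ofSize (inside ∷ p) {suc t} (s≤s t≤) =
  let q , q⊆p , ∣q∣ = ⊆-ofSize p t≤ in inside ∷ q , s⊆s q⊆p , cong suc ∣q∣

label : (Fin n → ℕ) → Subset n → Parity
label c []      = const false
label c (s ∷ σ) = (λ d → s ∧ single (c zero) d) ⊕ label (c ∘ suc) σ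

label-⊥ : ∀ (c : Fin n → ℕ) → label c ⊥ ≗ const false
label-⊥ {zero}  c d = refl
label-⊥ {suc n} c d = label-⊥ (c ∘ suc) d

label-⁅⁆ : ∀ (c : Fin n → ℕ) i → label c ⁅ i ⁆ ≗ single (c i)
label-⁅⁆ c zero    d = trans (cong (single (c zero) d xor_) (label-⊥ (c ∘ suc) d)) (xor-identityʳ _)
label-⁅⁆ c (suc i) d = label-⁅⁆ (c ∘ suc) i d

label-△ : ∀ (c : Fin n → ℕ) σ τ → label c (σ △ τ) ≗ label c σ ⊕ label c τ
label-△ c []      []      d = refl
label-△ c (s ∷ σ) (t ∷ τ) d = begin
  ((s xor t) ∧ u) xor label c′ (σ △ τ) d
    ≡⟨ cong₂ _xor_ (∧-distribʳ-xor u s t) (label-△ c′ σ τ d) ⟩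
  ((s ∧ u) xor (t ∧ u)) xor (label c′ σ d xor label c′ τ d)
    ≡⟨ interchange (s ∧ u) (t ∧ u) (label c′ σ d) (label c′ τ d) ⟩
  ((s ∧ u) xor label c′ σ d) xor ((t ∧ u) xor label c′ τ d) ∎
  where
  open ≡-Reasoning
  u = single (c zero) d
  c′ = c ∘ suc

bool↣fin2 : Bool ↣ Fin 2
bool↣fin2 = ↔⇒↣ (↔-sym 2↔Bool)

encode : (p : Subset n) → Subset n → Fin (2 ^ ∣ p ∣)
encode []            []      = zero
encode (outside ∷ p) (_ ∷ σ) = encode p σ
encode (inside ∷ p)  (s ∷ σ) = combine (Injection.to bool↣fin2 s) (encode p σ)

encode-injective : σ ⊆ p → τ ⊆ p → encode p σ ≡ encode p τ → σ ≡ τ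
encode-injective {σ = []} {p = []} {[]} _ _ _ = refl
encode-injective {σ = true ∷ σ} {p = outside ∷ p} σ⊆p _ _ with () ← σ⊆p Vec.here
encode-injective {σ = false ∷ σ} {p = outside ∷ p} {true ∷ τ} _ τ⊆p _ with () ← τ⊆p Vec.here
encode-injective {σ = false ∷ σ} {p = outside ∷ p} {false ∷ τ} σ⊆p τ⊆p eq =
  cong (false ∷_) (encode-injective (drop-∷-⊆ σ⊆p) (drop-∷-⊆ τ⊆p) eq)
encode-injective {σ = s ∷ σ} {p = inside ∷ p} {t ∷ τ} σ⊆p τ⊆p eq =
  cong₂ _∷_ (Injection.injective bool↣fin2 (combine-injectiveˡ s′ (encode p σ) t′ (encode p τ) eq))
            (encode-injective (drop-∷-⊆ σ⊆p) (drop-∷-⊆ τ⊆p) (combine-injectiveʳ s′ (encode p σ) t′ (encode p τ) eq))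
  where
  s′ = Injection.to bool↣fin2 s
  t′ = Injection.to bool↣fin2 t

injection⇒≤2^∣∣ : ∀ {m} (f : Fin m → Subset n) → (∀ i → f i ⊆ p) →
                  (∀ {i j} → f i ≡ f j → i ≡ j) → m ≤ 2 ^ ∣ p ∣
injection⇒≤2^∣∣ f f⊆p f-inj = injective⇒≤ λ eq → f-inj (encode-injective (f⊆p _) (f⊆p _) eq)

Unique⇒length≤ : ∀ {A : Set} {xs ys : List A} → Unique xs → (∀ {x} → x ∈ xs → x ∈ ys) → length xs ≤ length ys
Unique⇒length≤ {xs = []}     _            _     = z≤n
Unique⇒length≤ {xs = x ∷ xs} (x∉xs ∷ xs!) xs⊆ys with ∈-∃++ (xs⊆ys (here refl))
... | as , bs , refl = begin
  suc (length xs)              ≤⟨ s≤s (Unique⇒length≤ xs! xs⊆as++bs) ⟩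
  suc (length (as ++ bs))      ≡⟨ cong suc (length-++ as) ⟩
  suc (length as + length bs)  ≡⟨ +-suc _ _ ⟨
  length as + length (x ∷ bs)  ≡⟨ length-++ as ⟨
  length (as ++ x ∷ bs)        ∎
  where
  open ≤-Reasoning
  xs⊆as++bs : ∀ {y} → y ∈ xs → y ∈ as ++ bs
  xs⊆as++bs y∈xs with ∈-++⁻ as (xs⊆ys (there y∈xs))
  ... | inj₁ y∈as         = ∈-++⁺ˡ y∈as
  ... | inj₂ (here y≡x)   = ⊥-elim (All.lookup x∉xs y∈xs (≡.sym y≡x))
  ... | inj₂ (there y∈bs) = ∈-++⁺ʳ as y∈bs

map-unique : ∀ {A B : Set} {f : A → B} {xs} → (∀ {x y} → x ∈ xs → y ∈ xs → f x ≡ f y → x ≡ y) →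
             Unique xs → Unique (map f xs)
map-unique _   []           = []
map-unique inj (x∉xs ∷ xs!) =
  map⁺ (All.tabulate λ y∈xs fx≡fy → All.lookup x∉xs y∈xs (inj (here refl) (there y∈xs) fx≡fy))
  ∷ map-unique (λ x∈ y∈ → inj (there x∈) (there y∈)) xs!

concatMap-unique : ∀ {A B : Set} {P : Pred A ℓ} (f : A → List B) {xs} → Unique xs → All P xs →
                   (∀ x → Unique (f x)) → (∀ {x y} → P x → P y → x ≢ y → Disjoint (f x) (f y)) →
                   Unique (concatMap f xs)
concatMap-unique f []            []         _  _    = []
concatMap-unique f (x∉xs ∷ xs!) (px ∷ pxs) f! disj =
  Unique.++⁺ (f! _) (concatMap-unique f xs! pxs f! disj) λ (b∈fx , b∈rest) →
    let y , y∈xs , b∈fy = find (∈-concatMap⁻ f b∈rest)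
    in disj px (All.lookup pxs y∈xs) (All.lookup x∉xs y∈xs) (b∈fx , b∈fy)

-- Fresh vertices

module FreshVertices {n : ℕ} (G : Graph n) (φ : EdgeColoring G) where
  open Walks G φ

  private variable
    u v w : Fin n

  backNeighbours : Fin n → List (Fin n)
  backNeighbours i = filter (λ j → toℕ j <? toℕ i) (filter (λ j → T? (adj G i j)) (allFin n))

  ∈-backNeighbours⁻ : u ∈ backNeighbours v → u <ᶠ v × T (adj G v u)
  ∈-backNeighbours⁻ {u} {v} u∈ =
    let u∈adj , u<v = ∈-filter⁻ (λ j → toℕ j <? toℕ v) {xs = filter (λ j → T? (adj G v j)) (allFin n)} u∈
    in u<v , proj₂ (∈-filter⁻ (λ j → T? (adj G v j)) {xs = allFin n} u∈adj)

  RepeatsColour : Fin n → Set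
  RepeatsColour i = ∃ λ u → ∃ λ x → ∃ λ y →
    u <ᶠ i × T (adj G i u) × x <ᶠ i × y <ᶠ i × T (adj G x y) × col φ u i ≡ col φ x y

  repeatsColour? : Decidable RepeatsColour
  repeatsColour? i = any? λ u → any? λ x → any? λ y →
    u <ᶠ? i ×-dec T? (adj G i u) ×-dec x <ᶠ? i ×-dec y <ᶠ? i ×-dec T? (adj G x y) ×-dec col φ u i ≟ col φ x y

  freshVertices : Subset n
  freshVertices = satisfying (¬? ∘ repeatsColour?)

  backColours : Fin n → List ℕ
  backColours v = map (λ u → col φ u v) (backNeighbours v)

  backColours-unique : IsStrongParity G φ → ∀ v → Unique (backColours v)
  backColours-unique sp v = map-unique same⇒equal (Unique.filter⁺ _ (Unique.filter⁺ _ (Unique.allFin⁺ n)))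
    where
    same⇒equal : u ∈ backNeighbours v → w ∈ backNeighbours v → col φ u v ≡ col φ w v → u ≡ w
    same⇒equal {u} {w} u∈ w∈ same =
      closed sp (cast cancel (edge (T-adj-sym G (proj₂ (∈-backNeighbours⁻ u∈)))
                              ++ʷ edge (proj₂ (∈-backNeighbours⁻ w∈))))
      where
      cancel : single (col φ u v) ⊕ single (col φ v w) ≗ const false
      cancel d = trans (cong (λ c → single (col φ u v) d xor single c d) (trans (colSym φ v w) (≡.sym same)))
                       (xor-same (single (col φ u v) d))

  fresh-disjoint-earlier : w ∈ˢ freshVertices → v <ᶠ w → Disjoint (backColours v) (backColours w)
  fresh-disjoint-earlier {w} {v} w-fresh v<w (c∈v , c∈w)
    with ∈-map⁻ (λ u → col φ u v) c∈v | ∈-map⁻ (λ u → col φ u w) c∈w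
  ... | u , u∈ , refl | u′ , u′∈ , same =
    let u<v , v~u = ∈-backNeighbours⁻ u∈
        u′<w , w~u′ = ∈-backNeighbours⁻ u′∈
    in ∈-satisfying⁻ (¬? ∘ repeatsColour?) w-fresh
         (u′ , u , v , u′<w , w~u′ , <-trans u<v v<w , v<w , T-adj-sym G v~u , ≡.sym same)

  fresh-disjoint : v ∈ˢ freshVertices → w ∈ˢ freshVertices → v ≢ w → Disjoint (backColours v) (backColours w)
  fresh-disjoint {v} {w} v-fresh w-fresh v≢w with <-cmp v w
  ... | tri< v<w _ _ = fresh-disjoint-earlier w-fresh v<w
  ... | tri≈ _ v≡w _ = ⊥-elim (v≢w v≡w)
  ... | tri> _ _ w<v = λ (c∈v , c∈w) → fresh-disjoint-earlier v-fresh w<v (c∈w , c∈v)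

  backColour∈edgeColors : ∀ {c} → c ∈ backColours v → c ∈ edgeColors G φ
  backColour∈edgeColors {v} c∈ with ∈-map⁻ (λ u → col φ u v) c∈
  ... | u , u∈ , refl =
    let u<v , v~u = ∈-backNeighbours⁻ u∈
    in ∈-concatMap⁺ _ (lose (∈-allFin u) (∈-map⁺ (col φ u)
         (∈-filter⁺ (λ j → T? (adj G u j))
           (∈-filter⁺ (λ j → toℕ u <? toℕ j) (∈-allFin v) u<v) (T-adj-sym G v~u))))

  length-concatMap-backColours : ∀ vs → length (concatMap backColours vs) ≡ sum (map (backDeg G) vs)
  length-concatMap-backColours []       = refl
  length-concatMap-backColours (v ∷ vs) =
    trans (length-++ (backColours v))
          (cong₂ _+_ (length-map _ (backNeighbours v)) (length-concatMap-backColours vs))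

  backDegSum≤numColors : IsStrongParity G φ → ∀ {S} → S ⊆ freshVertices → backDegSum G S ≤ numColors G φ
  backDegSum≤numColors sp {S} S⊆fresh = begin
    backDegSum G S                     ≡⟨ length-concatMap-backColours vs ⟨
    length (concatMap backColours vs)  ≤⟨ Unique⇒length≤ distinct (∈-deduplicate⁺ _≟_ ∘ ∈edgeColors) ⟩
    numColors G φ                      ∎
    where
    open ≤-Reasoning
    vs = filter (_∈? S) (allFin n)
    distinct : Unique (concatMap backColours vs)
    distinct = concatMap-unique backColours
      (Unique.filter⁺ (_∈? S) (Unique.allFin⁺ n)) (all-filter (_∈? S) (allFin n)) (backColours-unique sp)
      (λ v∈S w∈S → fresh-disjoint (S⊆fresh v∈S) (S⊆fresh w∈S))
    ∈edgeColors : ∀ {c} → c ∈ concatMap backColours vs → c ∈ edgeColors G φ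
    ∈edgeColors c∈ =
      let _ , _ , c∈v = find (∈-concatMap⁻ backColours {xs = vs} c∈) in backColour∈edgeColors c∈v

-- Reaching every vertex from the first

module Reachability {m : ℕ} (G : Graph (suc m)) (φ : EdgeColoring G) (sp : IsStrongParity G φ)
  (hasBackNeighbour : ∀ (i : Fin (suc m)) → 0 < toℕ i → backDeg G i > 0) where
  open Walks G φ
  open FreshVertices G φ

  -- The value for a vertex without back neighbours is never used.
  firstBackColour : Fin (suc m) → ℕ
  firstBackColour i with backNeighbours i
  ... | []    = 0
  ... | u ∷ _ = col φ u i

  firstBackNeighbour : ∀ i → 0 < toℕ i → ∃ λ u → u ∈ backNeighbours i × firstBackColour i ≡ col φ u i
  firstBackNeighbour i i>0 with backNeighbours i | hasBackNeighbour i i>0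
  ... | u ∷ _ | _ = u , here refl , refl

  L : Subset (suc m) → Parity
  L = label firstBackColour

  Reach : Fin (suc m) → Set
  Reach i = Σ (Subset (suc m)) λ σ → σ ⊆ freshVertices × Walk zero i (L σ)

  reach-repeating : ∀ {i} → RepeatsColour i → (∀ {j} → j <ᶠ i → Reach j) → Reach i
  reach-repeating {i} (u , x , y , u<i , i~u , x<i , y<i , x~y , same) reach<
    with reach< u<i | reach< x<i | reach< y<i
  ... | σu , σu⊆ , wu | σx , σx⊆ , wx | σy , σy⊆ , wy =
    (σx △ σy) △ σu , △-⊆ (△-⊆ σx⊆ σy⊆) σu⊆ ,
    cast parities (((wx ++ʷ edge x~y) ++ʷ reverse wy) ++ʷ (wu ++ʷ edge (T-adj-sym G i~u)))
    where
    parities : ((L σx ⊕ single (col φ x y)) ⊕ L σy) ⊕ (L σu ⊕ single (col φ u i)) ≗ L ((σx △ σy) △ σu)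
    parities d = begin
      ((L σx d xor single (col φ x y) d) xor L σy d) xor (L σu d xor single (col φ u i) d)
        ≡⟨ cong (λ c → ((L σx d xor single (col φ x y) d) xor L σy d) xor (L σu d xor single c d)) same ⟩
      ((L σx d xor single (col φ x y) d) xor L σy d) xor (L σu d xor single (col φ x y) d)
        ≡⟨ xor-cancel (L σx d) (L σy d) (L σu d) (single (col φ x y) d) ⟩
      (L σx d xor L σy d) xor L σu d
        ≡⟨ cong (_xor L σu d) (label-△ firstBackColour σx σy d) ⟨
      L (σx △ σy) d xor L σu d
        ≡⟨ label-△ firstBackColour (σx △ σy) σu d ⟨
      L ((σx △ σy) △ σu) d ∎
      where open ≡-Reasoning

  reach-fresh : ∀ {i} → ¬ RepeatsColour i → 0 < toℕ i → (∀ {j} → j <ᶠ i → Reach j) → Reach i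
  reach-fresh {i} fresh i>0 reach< with firstBackNeighbour i i>0
  ... | u , u∈ , first≡ with ∈-backNeighbours⁻ u∈
  ... | u<i , i~u with reach< u<i
  ... | σu , σu⊆ , wu = σu △ ⁅ i ⁆ , △-⊆ σu⊆ ⁅i⁆⊆fresh , cast parities (wu ++ʷ edge (T-adj-sym G i~u))
    where
    ⁅i⁆⊆fresh : ⁅ i ⁆ ⊆ freshVertices
    ⁅i⁆⊆fresh j∈ =
      subst (_∈ˢ freshVertices) (≡.sym (x∈⁅y⁆⇒x≡y i j∈)) (∈-satisfying⁺ (¬? ∘ repeatsColour?) fresh)
    parities : L σu ⊕ single (col φ u i) ≗ L (σu △ ⁅ i ⁆)
    parities d = begin
      L σu d xor single (col φ u i) d          ≡⟨ cong (λ c → L σu d xor single c d) first≡ ⟨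
      L σu d xor single (firstBackColour i) d  ≡⟨ cong (L σu d xor_) (label-⁅⁆ firstBackColour i d) ⟨
      L σu d xor L ⁅ i ⁆ d                     ≡⟨ label-△ firstBackColour σu ⁅ i ⁆ d ⟨
      L (σu △ ⁅ i ⁆) d                         ∎
      where open ≡-Reasoning

  reach : ∀ i → Reach i
  reach = WF.All.wfRec <-wellFounded _ Reach step
    where
    step : ∀ i → (∀ {j} → j <ᶠ i → Reach j) → Reach i
    step zero    _ = ⊥ , ⊆-min freshVertices , cast (λ d → ≡.sym (label-⊥ firstBackColour d)) (stay zero)
    step (suc i) reach< with repeatsColour? (suc i)
    ... | yes repeats = reach-repeating repeats reach<
    ... | no fresh    = reach-fresh fresh (s≤s z≤n) reach<

  signature : Fin (suc m) → Subset (suc m)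
  signature i = proj₁ (reach i)

  signature-injective : ∀ {i j} → signature i ≡ signature j → i ≡ j
  signature-injective {i} {j} eq with reach i | reach j
  ... | σ , _ , wi | τ , _ , wj = closed sp (cast cancel (reverse wi ++ʷ wj))
    where
    cancel : L σ ⊕ L τ ≗ const false
    cancel d = trans (cong (λ ρ → L ρ d xor L τ d) eq) (xor-same (L τ d))

  ⌈log₂⌉≤∣freshVertices∣ : ⌈log₂ suc m ⌉ ≤ ∣ freshVertices ∣
  ⌈log₂⌉≤∣freshVertices∣ = begin
    ⌈log₂ suc m ⌉
      ≤⟨ ⌈log₂⌉-mono-≤ (injection⇒≤2^∣∣ signature (proj₁ ∘ proj₂ ∘ reach) signature-injective) ⟩
    ⌈log₂ 2 ^ ∣ freshVertices ∣ ⌉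
      ≡⟨ ⌈log₂2^n⌉≡n _ ⟩
    ∣ freshVertices ∣ ∎
    where open ≤-Reasoning

corollary3p4 : (n : ℕ) (G : Graph n)
    → (∀ (i : Fin n) → 0 < toℕ i → backDeg G i > 0)
    → (φ : EdgeColoring G) → IsStrongParity G φ
    → Σ (Subset n) (λ S → (∣ S ∣ ≡ ⌈log₂ n ⌉) × (backDegSum G S ≤ numColors G φ))
corollary3p4 zero    G _                _ _  = [] , refl , z≤n
corollary3p4 (suc m) G hasBackNeighbour φ sp =
  let open FreshVertices G φ
      open Reachability G φ sp hasBackNeighbour
      S , S⊆fresh , ∣S∣≡ = ⊆-ofSize freshVertices ⌈log₂⌉≤∣freshVertices∣
  in  S , ∣S∣≡ , backDegSum≤numColors sp S⊆fresh
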